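{- Let $k,q\ge1$ be integers. (1) If $2\le k-1\le\frac{q}{3+\log q}$, then there exists a connected graph $G\in\mathcal{TW}_{k-1}\cap\mathcal{TD}_q$ such that Robber has a winning strategy in $\mathrm{CR}^k_q(G)$. (2) If $q\ge3$, then there exists a connected graph $G'\in\mathcal{TW}_1\cap\mathcal{TD}_q$ such that Robber has a winning strategy in $\mathrm{CR}^2_q(G')$.
   Context: All graphs are finite, simple and loopless; $\log$ is base 2. $\mathcal{TW}_{k-1}$ is the class of graphs of treewidth at most $k-1$; $\mathcal{TD}_q$ is the class of graphs of treedepth at most $q$ (treedepth = minimum depth, i.e. maximum number of vertices on a root-to-leaf path, of a rooted forest on $V(G)$ in which every edge joins an ancestor-descendant pair). The game $\mathrm{CR}^k_q(G)$: Cop positions are sets $X\subseteq V(G)$ with $|X|\le k$, Robber positions are vertices. Let $\mathrm{esc}(X,v)=\{v\}$ if $v\in X$, else the vertex set of the component of $G-X$ containing $v$. Initially Cop is on $\emptyset$ and Robber chooses a vertex. In round $i$, Cop moves from $X_{i-1}$ to $X_i$ with $|X_i|\le k$, $|X_i\setminus X_{i-1}|\le1$; Robber then moves from $v$ to any $u\in\mathrm{esc}(X_i\cap X_{i-1},v)$. Cop wins if a position $(X,u)$ with $u\in X$ is reached; Robber wins if Cop has not won after $q$ rounds. -}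

module Defs where

open import Data.Nat using (ℕ; zero; suc; _≤_; _*_; _^_; _∸_)
open import Data.Fin using (Fin; zero; suc; inject₁; fromℕ)
open import Data.Fin.Subset using (Subset; _∈_; _∉_; _∩_; _─_; ∣_∣; ⊥)
open import Data.Maybe using (Maybe; just; nothing)
open import Data.Product using (Σ; _×_; ∃; ∃-syntax; _,_)
open import Data.Sum using (_⊎_)
open import Data.Unit using (⊤)
open import Relation.Nullary using (¬_)
open import Relation.Binary.PropositionalEquality using (_≡_)
open import Function.Definitions using (Injective)

record Graph (n : ℕ) : Set₁ where
  field
    E     : Fin n → Fin n → Set
    sym   : ∀ {u v} → E u v → E v u
    irrefl : ∀ {u} → ¬ E u u
open Graph public

data WalkIn {n : ℕ} (G : Graph n) (P : Fin n → Set) : Fin n → Fin n → Set where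
  here : ∀ {u} → P u → WalkIn G P u u
  step : ∀ {u w x} → WalkIn G P u w → E G w x → P x → WalkIn G P u x

Walk : {n : ℕ} → Graph n → Fin n → Fin n → Set
Walk G = WalkIn G (λ _ → ⊤)

Connected : {n : ℕ} → Graph n → Set
Connected G = ∀ u v → Walk G u v

-- A cycle of length l+3: injective closed walk.
HasCycle : {n : ℕ} → Graph n → Set
HasCycle {n} G = Σ ℕ λ l → Σ (Fin (suc (suc (suc l))) → Fin n) λ c →
  Injective _≡_ _≡_ c ×
  (∀ (i : Fin (suc (suc l))) → E G (c (inject₁ i)) (c (suc i))) ×
  E G (c (fromℕ (suc (suc l)))) (c zero)

IsTree : {m : ℕ} → Graph m → Set
IsTree T = Connected T × ¬ HasCycle T

record TreeDecomposition {n : ℕ} (G : Graph n) (w : ℕ) : Set₁ where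
  field
    m        : ℕ
    T        : Graph m
    isTree   : IsTree T
    bag      : Fin m → Subset n
    vcover   : ∀ v → ∃[ t ] (v ∈ bag t)
    ecover   : ∀ u v → E G u v → ∃[ t ] (u ∈ bag t × v ∈ bag t)
    coherent : ∀ v t t' → v ∈ bag t → v ∈ bag t' → WalkIn T (λ s → v ∈ bag s) t t'
    width    : ∀ t → ∣ bag t ∣ ≤ suc w

InTW : {n : ℕ} → ℕ → Graph n → Set₁
InTW w G = TreeDecomposition G w

-- Rooted forests on Fin n given by parent pointers with a depth function
-- (depth = number of vertices on the path to the root).
data Ancestor {n : ℕ} (par : Fin n → Maybe (Fin n)) : Fin n → Fin n → Set where
  self : ∀ {u} → Ancestor par u u
  up   : ∀ {u w v} → par v ≡ just w → Ancestor par u w → Ancestor par u v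

record RootedForest (n : ℕ) : Set where
  field
    par      : Fin n → Maybe (Fin n)
    depth    : Fin n → ℕ
    depthRoot : ∀ v → par v ≡ nothing → depth v ≡ 1
    depthPar : ∀ v w → par v ≡ just w → depth v ≡ suc (depth w)
open RootedForest public

InTD : {n : ℕ} → ℕ → Graph n → Set
InTD {n} q G = Σ (RootedForest n) λ F →
  (∀ u v → E G u v → Ancestor (par F) u v ⊎ Ancestor (par F) v u) ×
  (∀ v → depth F v ≤ q)

_∈esc[_,_]_ : {n : ℕ} → Fin n → Graph n → Subset n → Fin n → Set
u ∈esc[ G , Y ] v = (v ∈ Y × u ≡ v) ⊎ (v ∉ Y × WalkIn G (λ x → x ∉ Y) v u)

-- RobberSurvives G k r X v : in position (X, v) (with v ∉ X), Robber can
-- avoid capture for r further rounds of CR^k.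
RobberSurvives : {n : ℕ} → Graph n → ℕ → ℕ → Subset n → Fin n → Set
RobberSurvives G k zero X v = ⊤
RobberSurvives G k (suc r) X v =
  ∀ X' → ∣ X' ∣ ≤ k → ∣ X' ─ X ∣ ≤ 1 →
  ∃[ u ] (u ∈esc[ G , X ∩ X' ] v × u ∉ X' × RobberSurvives G k r X' u)

RobberWins : {n : ℕ} → Graph n → ℕ → ℕ → Set
RobberWins G k q = ∃[ v ] RobberSurvives G k q ⊥ v

module Submission where

-- Let a = k − 2, H ≥ 1, and let G be the path 0 — ⋯ — N − 1 on N = 2^H − 1 vertices joined
-- completely to an independent set A of a further vertices. The bags {i, i + 1} ∪ A along the path
-- show tw(G) ≤ a + 1, and a chain through A placed above a balanced binary search tree of the path
-- shows td(G) ≤ a + H. Robber starts in the middle of the path and moves only when Cop lands on him: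
-- each vertex has k distinct neighbours (its path neighbours and A, or k path vertices if it lies
-- in A), of which Cop's k pebbles cover at most k − 1. With r rounds left Robber keeps distance at
-- least r from both ends of the path, which is possible as long as N > 2q + a. The hypotheses give
-- such an H with a + H ≤ q: H = q − a when (8q)^(k−1) ≤ 2^q, and H = q, a = 0 when k = 2, q ≥ 3.

open import Defs
open import Data.Nat using (ℕ; zero; suc; pred; _+_; _*_; _^_; _∸_; _≤_; _<_; z≤n; s≤s; NonZero)
open import Data.Nat.Properties
open import Data.Nat.Tactic.RingSolver using (solve-∀)
open import Data.Fin using (Fin; zero; suc; toℕ; fromℕ<; inject₁; fromℕ)
import Data.Fin.Properties as Finₚ
open import Data.Fin.Properties using (toℕ-injective; toℕ-fromℕ<; toℕ-fromℕ; toℕ<n; toℕ-inject₁; ¬∀⟶∃¬; all?)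
open import Data.Fin.Subset using (Subset; _∈_; _∉_; _∪_; _∩_; _-_; ∣_∣; inside; outside; ⊥)
open import Data.Fin.Subset.Properties
  using (x∈p⇒∣p-x∣<∣p∣; x∈p∧x∉q⇒x∈p─q; x≢y⇒x∉⁅y⁆; _∈?_; p∩q⊆p; p∩q⊆q; x∈p∪q⁻; x∈p∪q⁺; ∉⊥)
open import Data.Vec using ([]; _∷_; here; there)
open import Data.Maybe using (Maybe; just; nothing; map; _<∣>_)
open import Data.Product using (Σ; _×_; ∃-syntax; _,_; proj₁; proj₂)
open import Data.Sum using (_⊎_; inj₁; inj₂)
open import Data.Unit using (⊤; tt)
open import Data.Empty using (⊥-elim)
open import Function using (_∘_)
open import Function.Definitions using (Injective)
open import Relation.Nullary using (¬_; yes; no)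
open import Relation.Binary.PropositionalEquality as ≡
  using (_≡_; _≢_; refl; trans; cong; subst; subst₂; module ≡-Reasoning)

module _ {n} {G : Graph n} {P : Fin n → Set} where

  walk-cons : ∀ {u w x} → E G u w → P u → WalkIn G P w x → WalkIn G P u x
  walk-cons e pu (here pw)         = step (here pu) e pw
  walk-cons e pu (step wk e′ px)  = step (walk-cons e pu wk) e′ px

  walk-reverse : ∀ {u v} → WalkIn G P u v → WalkIn G P v u
  walk-reverse (here p)        = here p
  walk-reverse (step wk e px) = walk-cons (Graph.sym G e) px (walk-reverse wk)

  walk-++ : ∀ {u v w} → WalkIn G P u v → WalkIn G P v w → WalkIn G P u w
  walk-++ wk (here _)         = wk
  walk-++ wk (step wk′ e p) = step (walk-++ wk wk′) e p

  walk-interval : ∀ (u v : Fin n) → toℕ u ≤ toℕ v →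
    (∀ z → toℕ u ≤ toℕ z → toℕ z ≤ toℕ v → P z) →
    (∀ z w → toℕ u ≤ toℕ z → toℕ w ≡ suc (toℕ z) → toℕ w ≤ toℕ v → E G z w) →
    WalkIn G P u v
  walk-interval u v u≤v = go (toℕ v ∸ toℕ u) v (≡.sym (m∸n+n≡m u≤v))
    where
    go : ∀ d v → toℕ v ≡ d + toℕ u →
      (∀ z → toℕ u ≤ toℕ z → toℕ z ≤ toℕ v → P z) →
      (∀ z w → toℕ u ≤ toℕ z → toℕ w ≡ suc (toℕ z) → toℕ w ≤ toℕ v → E G z w) →
      WalkIn G P u v
    go zero    v       eq hP hE with toℕ-injective eq
    ... | refl = here (hP u ≤-refl ≤-refl)
    go (suc d) (suc v) eq hP hE =
      step (go d (inject₁ v) v′≡ (λ z p q → hP z p (≤-trans q v′≤)) (λ z w p q r → hE z w p q (≤-trans r v′≤)))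
           (hE (inject₁ v) (suc v) (≤-trans (m≤n+m (toℕ u) d) (≤-reflexive (≡.sym v′≡)))
               (cong suc (≡.sym (toℕ-inject₁ v))) ≤-refl)
           (hP (suc v) (≤-trans (m≤n+m (toℕ u) (suc d)) (≤-reflexive (≡.sym eq))) ≤-refl)
      where
      v′≡ : toℕ (inject₁ v) ≡ d + toℕ u
      v′≡ = trans (toℕ-inject₁ v) (suc-injective eq)
      v′≤ : toℕ (inject₁ v) ≤ suc (toℕ v)
      v′≤ = ≤-trans (≤-reflexive (toℕ-inject₁ v)) (n≤1+n _)

injection⇒≤∣p∣ : ∀ {n} m (p : Subset n) (h : Fin m → Fin n) →
  Injective _≡_ _≡_ h → (∀ j → h j ∈ p) → m ≤ ∣ p ∣
injection⇒≤∣p∣ zero    p h h-inj h∈p = z≤n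
injection⇒≤∣p∣ (suc m) p h h-inj h∈p =
  ≤-trans (s≤s (injection⇒≤∣p∣ m (p - h zero) (h ∘ suc) (Finₚ.suc-injective ∘ h-inj) h∘suc∈p-h0))
          (x∈p⇒∣p-x∣<∣p∣ (h∈p zero))
  where
  h∘suc∈p-h0 : ∀ j → h (suc j) ∈ p - h zero
  h∘suc∈p-h0 j = x∈p∧x∉q⇒x∈p─q (h∈p (suc j)) (x≢y⇒x∉⁅y⁆ λ e → Finₚ.0≢1+n (≡.sym (h-inj e)))

pigeonhole-∉ : ∀ {n} k (X : Subset n) (v : Fin n) (nb : Fin k → Fin n) →
  v ∈ X → ∣ X ∣ ≤ k → Injective _≡_ _≡_ nb → (∀ j → nb j ≢ v) → ∃[ j ] (nb j ∉ X)
pigeonhole-∉ {n} k X v nb v∈X ∣X∣≤k nb-inj nb≢v with all? (λ j → nb j ∈? X)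
... | no ¬all  = ¬∀⟶∃¬ k (λ j → nb j ∈ X) (λ j → nb j ∈? X) ¬all
... | yes all = ⊥-elim (1+n≰n (≤-trans (injection⇒≤∣p∣ (suc k) X h h-inj h∈X) ∣X∣≤k))
  where
  h : Fin (suc k) → Fin n
  h zero    = v
  h (suc j) = nb j
  h-inj : Injective _≡_ _≡_ h
  h-inj {zero}  {zero}  e = refl
  h-inj {zero}  {suc j} e = ⊥-elim (nb≢v j (≡.sym e))
  h-inj {suc i} {zero}  e = ⊥-elim (nb≢v i e)
  h-inj {suc i} {suc j} e = cong suc (nb-inj e)
  h∈X : ∀ j → h j ∈ X
  h∈X zero    = v∈X
  h∈X (suc j) = all j

∣p∪q∣≤∣p∣+∣q∣ : ∀ {n} (p q : Subset n) → ∣ p ∪ q ∣ ≤ ∣ p ∣ + ∣ q ∣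
∣p∪q∣≤∣p∣+∣q∣ []            []            = z≤n
∣p∪q∣≤∣p∣+∣q∣ (outside ∷ p) (outside ∷ q) = ∣p∪q∣≤∣p∣+∣q∣ p q
∣p∪q∣≤∣p∣+∣q∣ (outside ∷ p) (inside ∷ q)  = ≤-trans (s≤s (∣p∪q∣≤∣p∣+∣q∣ p q)) (≤-reflexive (≡.sym (+-suc ∣ p ∣ ∣ q ∣)))
∣p∪q∣≤∣p∣+∣q∣ (inside ∷ p)  (outside ∷ q) = s≤s (∣p∪q∣≤∣p∣+∣q∣ p q)
∣p∪q∣≤∣p∣+∣q∣ (inside ∷ p)  (inside ∷ q)  =
  s≤s (≤-trans (∣p∪q∣≤∣p∣+∣q∣ p q) (≤-trans (n≤1+n _) (≤-reflexive (≡.sym (+-suc ∣ p ∣ ∣ q ∣)))))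

interval : ∀ n → ℕ → ℕ → Subset n
interval zero    _        _        = []
interval (suc n) zero     zero     = outside ∷ interval n zero zero
interval (suc n) zero     (suc hi) = inside ∷ interval n zero hi
interval (suc n) (suc lo) zero     = outside ∷ interval n lo zero
interval (suc n) (suc lo) (suc hi) = outside ∷ interval n lo hi

∣interval∣ : ∀ n lo hi → ∣ interval n lo hi ∣ ≤ hi ∸ lo
∣interval∣ zero    _        _        = z≤n
∣interval∣ (suc n) zero     zero     = ∣interval∣ n zero zero
∣interval∣ (suc n) zero     (suc hi) = s≤s (∣interval∣ n zero hi)
∣interval∣ (suc n) (suc lo) zero     = ≤-trans (∣interval∣ n lo zero) (≤-reflexive (0∸n≡0 lo))
∣interval∣ (suc n) (suc lo) (suc hi) = ∣interval∣ n lo hi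

interval-∈⁺ : ∀ {n lo hi} (x : Fin n) → lo ≤ toℕ x → toℕ x < hi → x ∈ interval n lo hi
interval-∈⁺ {suc n} {zero}   {suc hi} zero    _         _           = here
interval-∈⁺ {suc n} {zero}   {suc hi} (suc x) _         (s≤s x<hi)  = there (interval-∈⁺ x z≤n x<hi)
interval-∈⁺ {suc n} {suc lo} {suc hi} (suc x) (s≤s lo≤x) (s≤s x<hi) = there (interval-∈⁺ x lo≤x x<hi)

interval-∈⁻ : ∀ {n lo hi} (x : Fin n) → x ∈ interval n lo hi → lo ≤ toℕ x × toℕ x < hi
interval-∈⁻ {suc n} {zero}   {zero}   (suc x) (there x∈) with interval-∈⁻ x x∈
... | _ , ()
interval-∈⁻ {suc n} {zero}   {suc hi} zero    here       = z≤n , s≤s z≤n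
interval-∈⁻ {suc n} {zero}   {suc hi} (suc x) (there x∈) with interval-∈⁻ x x∈
... | _ , x<hi = z≤n , s≤s x<hi
interval-∈⁻ {suc n} {suc lo} {zero}   (suc x) (there x∈) with interval-∈⁻ x x∈
... | _ , ()
interval-∈⁻ {suc n} {suc lo} {suc hi} (suc x) (there x∈) with interval-∈⁻ x x∈
... | lo≤x , x<hi = s≤s lo≤x , s≤s x<hi

-- min x n; only ever applied to x ≤ n.
clamp : ∀ {n} → ℕ → Fin (suc n)
clamp {n} x = fromℕ< (s≤s (m⊓n≤n x n))

toℕ-clamp : ∀ {n} x → x < suc n → toℕ (clamp {n} x) ≡ x
toℕ-clamp {n} x (s≤s x≤n) = trans (toℕ-fromℕ< (s≤s (m⊓n≤n x n))) (m≤n⇒m⊓n≡m x≤n)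

clamp-toℕ : ∀ {n} (i : Fin (suc n)) → clamp (toℕ i) ≡ i
clamp-toℕ i = toℕ-injective (toℕ-clamp (toℕ i) (toℕ<n i))

graphOnℕ : (n : ℕ) (R : ℕ → ℕ → Set) → (∀ {x y} → R x y → R y x) → (∀ {x} → ¬ R x x) → Graph n
graphOnℕ n R R-sym R-irrefl = record
  { E = λ u v → R (toℕ u) (toℕ v) ; sym = R-sym ; irrefl = R-irrefl }

Adjacent : ℕ → ℕ → Set
Adjacent x y = y ≡ suc x ⊎ x ≡ suc y

Adjacent-sym : ∀ {x y} → Adjacent x y → Adjacent y x
Adjacent-sym (inj₁ e) = inj₂ e
Adjacent-sym (inj₂ e) = inj₁ e

Adjacent-irrefl : ∀ {x} → ¬ Adjacent x x
Adjacent-irrefl (inj₁ e) = 1+n≢n (≡.sym e)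
Adjacent-irrefl (inj₂ e) = 1+n≢n (≡.sym e)

PathGraph : (m : ℕ) → Graph m
PathGraph m = graphOnℕ m Adjacent Adjacent-sym Adjacent-irrefl

module _ (f : ℕ → ℕ) (L : ℕ)
  (f-steps : ∀ j → j < L → Adjacent (f j) (f (suc j)))
  (f-inj : ∀ i j → i ≤ L → j ≤ L → f i ≡ f j → i ≡ j) where

  private
    no-backtrack : ∀ j → suc (suc j) ≤ L → f (suc (suc j)) ≢ f j
    no-backtrack j j+2≤L e = m≢1+n+m j (≡.sym (f-inj _ _ j+2≤L (≤-trans (n≤1+n _) (≤-trans (n≤1+n _) j+2≤L)) e))

  ascending : f 1 ≡ suc (f 0) → ∀ j → suc j ≤ L → f j ≡ j + f 0 × f (suc j) ≡ suc j + f 0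
  ascending rising zero    _     = refl , rising
  ascending rising (suc j) j+2≤L with ascending rising j (≤-trans (n≤1+n _) j+2≤L) | f-steps (suc j) j+2≤L
  ... | fj , fj+1 | inj₁ e = fj+1 , trans e (cong suc fj+1)
  ... | fj , fj+1 | inj₂ e =
    ⊥-elim (no-backtrack j j+2≤L (suc-injective (trans (≡.sym e) (trans fj+1 (cong suc (≡.sym fj))))))

  descending : f 0 ≡ suc (f 1) → ∀ j → suc j ≤ L → f j + j ≡ f 0 × f (suc j) + suc j ≡ f 0
  descending falling zero    _     = +-identityʳ _ , trans (+-comm (f 1) 1) (≡.sym falling)
  descending falling (suc j) j+2≤L with descending falling j (≤-trans (n≤1+n _) j+2≤L) | f-steps (suc j) j+2≤L
  ... | fj , fj+1 | inj₂ e = fj+1 , trans (+-suc _ (suc j)) (trans (cong (_+ suc j) (≡.sym e)) fj+1)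
  ... | fj , fj+1 | inj₁ e = ⊥-elim (no-backtrack j j+2≤L (+-cancelʳ-≡ j _ _
    (trans (cong (_+ j) e) (trans (≡.sym (+-suc (f (suc j)) j)) (trans fj+1 (≡.sym fj))))))

  -- An injective ±1 walk is monotone, so it cannot return next to its start after L ≥ 2 steps.
  unitStep-no-return : 2 ≤ L → ¬ Adjacent (f L) (f 0)
  unitStep-no-return (s≤s (s≤s {n = l} _)) closing with f-steps 0 (s≤s z≤n)
  ... | inj₁ rising with ascending rising (suc l) ≤-refl | closing
  ...   | _ , fL | inj₁ e = m≢1+n+m (f 0) (trans e (cong suc fL))
  ...   | _ , fL | inj₂ e = m≢1+n+m (f 0) (≡.sym (suc-injective (trans (≡.sym fL) e)))
  unitStep-no-return (s≤s (s≤s {n = l} _)) closing | inj₂ falling with descending falling (suc l) ≤-refl | closing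
  ...   | _ , fL | inj₁ e =
    1+n≢0 (suc-injective (+-cancelˡ-≡ (f (suc (suc l))) (suc (suc l)) 1 (trans fL (trans e (+-comm 1 _)))))
  ...   | _ , fL | inj₂ e =
    m≢1+n+m (f 0) (trans (≡.sym fL) (trans (cong (_+ suc (suc l)) e) (cong suc (+-comm (f 0) _))))

PathGraph-acyclic : ∀ m → ¬ HasCycle (PathGraph m)
PathGraph-acyclic m (l , c , c-inj , c-steps , c-close) =
  unitStep-no-return f (suc (suc l)) f-steps f-inj (s≤s (s≤s z≤n)) f-close
  where
  f : ℕ → ℕ
  f j = toℕ (c (clamp j))
  clamp-≡ : ∀ (i : Fin (suc (suc (suc l)))) {x} → toℕ i ≡ x → clamp x ≡ i
  clamp-≡ i refl = clamp-toℕ i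
  f-steps : ∀ j → j < suc (suc l) → Adjacent (f j) (f (suc j))
  f-steps j j<L = subst₂ (λ x y → Adjacent (toℕ (c x)) (toℕ (c y)))
    (≡.sym (clamp-≡ (inject₁ i) (trans (toℕ-inject₁ i) (toℕ-fromℕ< j<L))))
    (≡.sym (clamp-≡ (suc i) (cong suc (toℕ-fromℕ< j<L))))
    (c-steps i)
    where
    i : Fin (suc (suc l))
    i = fromℕ< j<L
  f-inj : ∀ i j → i ≤ suc (suc l) → j ≤ suc (suc l) → f i ≡ f j → i ≡ j
  f-inj i j i≤L j≤L e =
    trans (≡.sym (toℕ-clamp i (s≤s i≤L))) (trans (cong toℕ (c-inj (toℕ-injective e))) (toℕ-clamp j (s≤s j≤L)))
  f-close : Adjacent (f (suc (suc l))) (f 0)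
  f-close = subst (λ x → Adjacent (toℕ (c x)) (f 0))
    (≡.sym (clamp-≡ (fromℕ (suc (suc l))) (toℕ-fromℕ (suc (suc l))))) c-close

PathGraph-convex-walk : ∀ {m} (P : Fin m → Set) →
  (∀ {t s t′} → P t → P t′ → toℕ t ≤ toℕ s → toℕ s ≤ toℕ t′ → P s) →
  ∀ t t′ → P t → P t′ → WalkIn (PathGraph m) P t t′
PathGraph-convex-walk P convex t t′ pt pt′ with ≤-total (toℕ t) (toℕ t′)
... | inj₁ t≤t′ = walk-interval t t′ t≤t′ (λ s t≤s s≤t′ → convex pt pt′ t≤s s≤t′) (λ _ _ _ e _ → inj₁ e)
... | inj₂ t′≤t = walk-reverse
  (walk-interval t′ t t′≤t (λ s t′≤s s≤t → convex pt′ pt t′≤s s≤t) (λ _ _ _ e _ → inj₁ e))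

PathGraph-isTree : ∀ m → IsTree (PathGraph m)
PathGraph-isTree m = (λ s t → PathGraph-convex-walk (λ _ → ⊤) _ s t tt tt) , PathGraph-acyclic m

data Ancestorℕ (p : ℕ → Maybe ℕ) : ℕ → ℕ → Set where
  self : ∀ {u} → Ancestorℕ p u u
  up   : ∀ {u w v} → p v ≡ just w → Ancestorℕ p u w → Ancestorℕ p u v

module _ {p : ℕ → Maybe ℕ} where

  Ancestorℕ-trans : ∀ {u w v} → Ancestorℕ p u w → Ancestorℕ p w v → Ancestorℕ p u v
  Ancestorℕ-trans a self       = a
  Ancestorℕ-trans a (up e b) = up e (Ancestorℕ-trans a b)

  Ancestorℕ-mono : ∀ {p′ u v} → (∀ {z w} → p z ≡ just w → p′ z ≡ just w) →
    Ancestorℕ p u v → Ancestorℕ p′ u v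
  Ancestorℕ-mono p⊆p′ self       = self
  Ancestorℕ-mono p⊆p′ (up e a) = up (p⊆p′ e) (Ancestorℕ-mono p⊆p′ a)

record ForestOnℕ (n : ℕ) : Set where
  field
    parent         : ℕ → Maybe ℕ
    depthOf        : ℕ → ℕ
    parent-<       : ∀ {x w} → x < n → parent x ≡ just w → w < n
    depthOf-root   : ∀ {x} → x < n → parent x ≡ nothing → depthOf x ≡ 1
    depthOf-parent : ∀ {x w} → x < n → parent x ≡ just w → depthOf x ≡ suc (depthOf w)

module _ {n} (F : ForestOnℕ (suc n)) where
  open ForestOnℕ F

  toRootedForest : RootedForest (suc n)
  toRootedForest = record
    { par = λ v → map clamp (parent (toℕ v)) ; depth = λ v → depthOf (toℕ v)
    ; depthRoot = root ; depthPar = nonroot }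
    where
    root : ∀ v → map clamp (parent (toℕ v)) ≡ nothing → depthOf (toℕ v) ≡ 1
    root v e with parent (toℕ v) in eq
    root v refl | nothing = depthOf-root (toℕ<n v) eq
    nonroot : ∀ v w → map clamp (parent (toℕ v)) ≡ just w → depthOf (toℕ v) ≡ suc (depthOf (toℕ w))
    nonroot v w e with parent (toℕ v) in eq
    nonroot v w refl | just w′ rewrite toℕ-clamp {n} w′ (parent-< (toℕ<n v) eq) = depthOf-parent (toℕ<n v) eq

  Ancestorℕ⇒Ancestor : ∀ {x y} → Ancestorℕ parent x y → x < suc n → y < suc n →
    Ancestor (par toRootedForest) (clamp x) (clamp y)
  Ancestorℕ⇒Ancestor self     x< y< = self
  Ancestorℕ⇒Ancestor (up e a) x< y< =
    up (par-clamp y< e) (Ancestorℕ⇒Ancestor a x< (parent-< y< e))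
    where
    par-clamp : ∀ {y w} → y < suc n → parent y ≡ just w → par toRootedForest (clamp y) ≡ just (clamp w)
    par-clamp {y} y< e rewrite toℕ-clamp {n} y y< | e = refl

InTD-fromForestOnℕ : ∀ {n q} (G : Graph (suc n)) (F : ForestOnℕ (suc n)) → let open ForestOnℕ F in
  (∀ u v → E G u v → Ancestorℕ parent (toℕ u) (toℕ v) ⊎ Ancestorℕ parent (toℕ v) (toℕ u)) →
  (∀ x → x < suc n → depthOf x ≤ q) → InTD q G
InTD-fromForestOnℕ G F comparable depth≤ =
  toRootedForest F , edge , λ v → depth≤ (toℕ v) (toℕ<n v)
  where
  transfer : ∀ {u v} → Ancestorℕ (ForestOnℕ.parent F) (toℕ u) (toℕ v) → Ancestor (par (toRootedForest F)) u v
  transfer {u} {v} a = subst₂ (Ancestor _) (clamp-toℕ u) (clamp-toℕ v) (Ancestorℕ⇒Ancestor F a (toℕ<n u) (toℕ<n v))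
  edge : ∀ u v → E G u v → Ancestor (par (toRootedForest F)) u v ⊎ Ancestor (par (toRootedForest F)) v u
  edge u v e with comparable u v e
  ... | inj₁ a = inj₁ (transfer a)
  ... | inj₂ a = inj₂ (transfer a)

InTD-mono : ∀ {n q q′} {G : Graph n} → q ≤ q′ → InTD q G → InTD q′ G
InTD-mono q≤q′ (F , edge , depth≤) = F , edge , λ v → ≤-trans (depth≤ v) q≤q′

-- Robber's strategy

EscapeRoutes : ∀ {n} → Graph n → ℕ → (Fin n → Set) → Fin n → Set
EscapeRoutes {n} G k P v = Σ (Fin k → Fin n) λ nb →
  Injective _≡_ _≡_ nb × (∀ j → nb j ≢ v) × (∀ j → E G v (nb j)) × (∀ j → P (nb j))

module _ {n} (G : Graph n) (k : ℕ) (Safe : ℕ → Fin n → Set)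
  (Safe-pred : ∀ {r v} → Safe (suc r) v → Safe r v)
  (escape : ∀ {r v} → Safe (suc r) v → EscapeRoutes G k (Safe r) v) where

  safe⇒survives : ∀ r X v → v ∉ X → Safe r v → RobberSurvives G k r X v
  safe⇒survives zero    X v _   _    = tt
  safe⇒survives (suc r) X v v∉X safe X′ ∣X′∣≤k _ with v ∈? X′
  ... | no v∉X′ = v , inj₂ (v∉X∩X′ , here v∉X∩X′) , v∉X′ , safe⇒survives r X′ v v∉X′ (Safe-pred safe)
    where
    v∉X∩X′ : v ∉ X ∩ X′
    v∉X∩X′ = v∉X ∘ p∩q⊆p X X′
  ... | yes v∈X′ with escape safe
  ...   | nb , nb-inj , nb≢v , nb-adj , nb-safe with pigeonhole-∉ k X′ v nb v∈X′ ∣X′∣≤k nb-inj nb≢v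
  ...     | j , nbj∉X′ =
    nb j , inj₂ (v∉X∩X′ , step (here v∉X∩X′) (nb-adj j) (nbj∉X′ ∘ p∩q⊆q X X′)) , nbj∉X′ ,
    safe⇒survives r X′ (nb j) nbj∉X′ (nb-safe j)
    where
    v∉X∩X′ : v ∉ X ∩ X′
    v∉X∩X′ = v∉X ∘ p∩q⊆p X X′

escapeRoutesOnℕ : ∀ {n k R} {R-sym : ∀ {x y} → R x y → R y x} {R-irrefl : ∀ {x} → ¬ R x x}
  {P : ℕ → Set} (v : Fin n) (g : Fin k → ℕ) → (∀ j → g j < n) → Injective _≡_ _≡_ g →
  (∀ j → g j ≢ toℕ v) → (∀ j → R (toℕ v) (g j)) → (∀ j → P (g j)) →
  EscapeRoutes (graphOnℕ n R R-sym R-irrefl) k (P ∘ toℕ) v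
escapeRoutesOnℕ {n} {k} {R} {P = P} v g g<n g-inj g≢v g-adj g-P =
  nb , g-inj ∘ ≡-via-toℕ , (λ j e → g≢v j (trans (≡.sym (toℕ-nb j)) (cong toℕ e))) ,
  (λ j → subst (R (toℕ v)) (≡.sym (toℕ-nb j)) (g-adj j)) ,
  (λ j → subst P (≡.sym (toℕ-nb j)) (g-P j))
  where
  nb : Fin k → Fin n
  nb j = fromℕ< (g<n j)
  toℕ-nb : ∀ j → toℕ (nb j) ≡ g j
  toℕ-nb j = toℕ-fromℕ< (g<n j)
  ≡-via-toℕ : ∀ {i j} → nb i ≡ nb j → g i ≡ g j
  ≡-via-toℕ {i} {j} e = trans (≡.sym (toℕ-nb i)) (trans (cong toℕ e) (toℕ-nb j))

-- Balanced binary search trees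

treeSize : ℕ → ℕ
treeSize zero    = 0
treeSize (suc h) = suc (treeSize h + treeSize h)

InTree : ℕ → ℕ → ℕ → Set
InTree L o x = o ≤ x × x < o + treeSize L

InTree-zero : ∀ {o x} → ¬ InTree 0 o x
InTree-zero {o} {x} (o≤x , x<o+0) = <⇒≱ x<o+0 (subst (_≤ x) (≡.sym (+-identityʳ o)) o≤x)

-- The perfect binary tree of height suc L on o, …, o + treeSize (suc L) - 1 has its root at
-- o + treeSize L, a left subtree on the positions below and a right subtree above.
data Position (L o x : ℕ) : Set where
  before : x < o → Position L o x
  left   : InTree L o x → Position L o x
  root   : x ≡ o + treeSize L → Position L o x
  right  : InTree L (suc (o + treeSize L)) x → Position L o x
  after  : o + treeSize (suc L) ≤ x → Position L o x

rightEnd : ∀ o L → suc (o + treeSize L) + treeSize L ≡ o + treeSize (suc L)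
rightEnd o L = ≡.sym (trans (+-suc o _) (cong suc (≡.sym (+-assoc o (treeSize L) (treeSize L)))))

position : ∀ L o x → Position L o x
position L o x with x <? o
... | yes x<o = before x<o
... | no x≮o with x <? o + treeSize L
...   | yes x<r = left (≮⇒≥ x≮o , x<r)
...   | no x≮r with x ≟ o + treeSize L
...     | yes x≡r = root x≡r
...     | no x≢r with x <? o + treeSize (suc L)
...       | yes x<e = right (≤∧≢⇒< (≮⇒≥ x≮r) (x≢r ∘ ≡.sym) , subst (x <_) (≡.sym (rightEnd o L)) x<e)
...       | no x≮e = after (≮⇒≥ x≮e)

bstParent : ℕ → ℕ → ℕ → Maybe ℕ
bstParent zero    o x = nothing
bstParent (suc L) o x with position L o x
... | left _  = bstParent L o x <∣> just (o + treeSize L)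
... | right _ = bstParent L (suc (o + treeSize L)) x <∣> just (o + treeSize L)
... | _       = nothing

bstDepth : ℕ → ℕ → ℕ → ℕ
bstDepth zero    o x = 0
bstDepth (suc L) o x with position L o x
... | left _  = suc (bstDepth L o x)
... | right _ = suc (bstDepth L (suc (o + treeSize L)) x)
... | _       = 1

bstDepth-≤ : ∀ L o x → bstDepth L o x ≤ L
bstDepth-≤ zero    o x = z≤n
bstDepth-≤ (suc L) o x with position L o x
... | before _ = s≤s z≤n
... | left _   = s≤s (bstDepth-≤ L o x)
... | root _   = s≤s z≤n
... | right _  = s≤s (bstDepth-≤ L _ x)
... | after _  = s≤s z≤n

<∣>-just : ∀ {m m′ : Maybe ℕ} {w} → (m <∣> m′) ≡ just w → m ≡ just w ⊎ (m ≡ nothing × m′ ≡ just w)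
<∣>-just {just _}  refl = inj₁ refl
<∣>-just {nothing} e    = inj₂ (refl , e)

<∣>-nothing : ∀ {m m′ : Maybe ℕ} → (m <∣> m′) ≡ nothing → m ≡ nothing × m′ ≡ nothing
<∣>-nothing {nothing} e = refl , e

InTree-left : ∀ {L o x} → InTree L o x → InTree (suc L) o x
InTree-left {L} {o} (o≤x , x<r) = o≤x , <-trans x<r (+-monoʳ-< o (s≤s (m≤m+n (treeSize L) _)))

InTree-right : ∀ {L o x} → InTree L (suc (o + treeSize L)) x → InTree (suc L) o x
InTree-right {L} {o} {x} (r<x , x<e) = ≤-trans (m≤m+n o _) (<⇒≤ r<x) , subst (x <_) (rightEnd o L) x<e

InTree-root : ∀ L o → InTree (suc L) o (o + treeSize L)
InTree-root L o = m≤m+n o _ , +-monoʳ-< o (s≤s (m≤m+n (treeSize L) _))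

root<end : ∀ L o → o + treeSize L < o + treeSize (suc L)
root<end L o = proj₂ (InTree-root L o)

bstParent-range : ∀ L o x {w} → bstParent L o x ≡ just w → InTree L o x × InTree L o w
bstParent-range (suc L) o x e with position L o x
bstParent-range (suc L) o x e | left x∈ with <∣>-just e
... | inj₁ e′ = InTree-left x∈ , InTree-left (proj₂ (bstParent-range L o x e′))
... | inj₂ (_ , refl) = InTree-left x∈ , InTree-root L o
bstParent-range (suc L) o x e | right x∈ with <∣>-just e
... | inj₁ e′ = InTree-right x∈ , InTree-right (proj₂ (bstParent-range L _ x e′))
... | inj₂ (_ , refl) = InTree-right x∈ , InTree-root L o

position-left : ∀ {L o x} → InTree L o x → (p : Position L o x) → ∃[ x∈ ] (p ≡ left x∈)
position-left (o≤x , x<r) (before x<o)       = ⊥-elim (<⇒≱ x<o o≤x)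
position-left (o≤x , x<r) (left x∈)          = x∈ , refl
position-left (o≤x , x<r) (root refl)        = ⊥-elim (<-irrefl refl x<r)
position-left (o≤x , x<r) (right (r<x , _)) = ⊥-elim (<-asym x<r r<x)
position-left {L} {o} (o≤x , x<r) (after e≤x) = ⊥-elim (<⇒≱ (<-trans x<r (root<end L o)) e≤x)

position-root : ∀ L o (p : Position L o (o + treeSize L)) → p ≡ root refl
position-root L o (before r<o)      = ⊥-elim (<⇒≱ r<o (m≤m+n o _))
position-root L o (left (_ , r<r))  = ⊥-elim (<-irrefl refl r<r)
position-root L o (root refl)       = refl
position-root L o (right (r<r , _)) = ⊥-elim (1+n≰n r<r)
position-root L o (after e≤r)       = ⊥-elim (<⇒≱ (root<end L o) e≤r)

position-right : ∀ {L o x} → InTree L (suc (o + treeSize L)) x → (p : Position L o x) → ∃[ x∈ ] (p ≡ right x∈)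
position-right {L} {o} x∈ p with InTree-right {L} {o} x∈
position-right (r<x , _) (before x<o)       | (o≤x , _) = ⊥-elim (<⇒≱ x<o o≤x)
position-right (r<x , _) (left (_ , x<r))   | _ = ⊥-elim (<-asym x<r r<x)
position-right (r<x , _) (root refl)        | _ = ⊥-elim (1+n≰n r<x)
position-right x∈        (right x∈′)        | _ = x∈′ , refl
position-right _         (after e≤x)        | (_ , x<e) = ⊥-elim (<⇒≱ x<e e≤x)

module _ {L o : ℕ} where

  bstParent-left : ∀ {x} → InTree L o x → bstParent (suc L) o x ≡ bstParent L o x <∣> just (o + treeSize L)
  bstParent-left {x} x∈ with position L o x | position-left x∈ (position L o x)
  ... | _ | _ , refl = refl

  bstParent-right : ∀ {x} → InTree L (suc (o + treeSize L)) x →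
    bstParent (suc L) o x ≡ bstParent L (suc (o + treeSize L)) x <∣> just (o + treeSize L)
  bstParent-right {x} x∈ with position L o x | position-right x∈ (position L o x)
  ... | _ | _ , refl = refl

  bstParent-root : bstParent (suc L) o (o + treeSize L) ≡ nothing
  bstParent-root with position L o (o + treeSize L) | position-root L o (position L o (o + treeSize L))
  ... | _ | refl = refl

  bstDepth-left : ∀ {x} → InTree L o x → bstDepth (suc L) o x ≡ suc (bstDepth L o x)
  bstDepth-left {x} x∈ with position L o x | position-left x∈ (position L o x)
  ... | _ | _ , refl = refl

  bstDepth-right : ∀ {x} → InTree L (suc (o + treeSize L)) x →
    bstDepth (suc L) o x ≡ suc (bstDepth L (suc (o + treeSize L)) x)
  bstDepth-right {x} x∈ with position L o x | position-right x∈ (position L o x)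
  ... | _ | _ , refl = refl

  bstDepth-root : bstDepth (suc L) o (o + treeSize L) ≡ 1
  bstDepth-root with position L o (o + treeSize L) | position-root L o (position L o (o + treeSize L))
  ... | _ | refl = refl

  bstParent-left-⊆ : ∀ {z w} → bstParent L o z ≡ just w → bstParent (suc L) o z ≡ just w
  bstParent-left-⊆ {z} e rewrite bstParent-left (proj₁ (bstParent-range L o z e)) | e = refl

  bstParent-right-⊆ : ∀ {z w} → bstParent L (suc (o + treeSize L)) z ≡ just w → bstParent (suc L) o z ≡ just w
  bstParent-right-⊆ {z} e rewrite bstParent-right (proj₁ (bstParent-range L _ z e)) | e = refl

bstParent≡nothing⇒bstDepth≡1 : ∀ L o x → InTree L o x → bstParent L o x ≡ nothing → bstDepth L o x ≡ 1
bstParent≡nothing⇒bstDepth≡1 zero    o x x∈ _ = ⊥-elim (InTree-zero x∈)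
bstParent≡nothing⇒bstDepth≡1 (suc L) o x (o≤x , x<e) e with position L o x
... | before x<o = ⊥-elim (<⇒≱ x<o o≤x)
... | left _     with () ← proj₂ (<∣>-nothing {bstParent L o x} e)
... | root _     = refl
... | right _    with () ← proj₂ (<∣>-nothing {bstParent L _ x} e)
... | after e≤x  = ⊥-elim (<⇒≱ x<e e≤x)

bstDepth-parent : ∀ L o x {w} → bstParent L o x ≡ just w → bstDepth L o x ≡ suc (bstDepth L o w)
bstDepth-parent (suc L) o x e with position L o x
bstDepth-parent (suc L) o x e | left x∈ with <∣>-just e
... | inj₁ e′ rewrite bstDepth-left {L} {o} (proj₂ (bstParent-range L o x e′)) = cong suc (bstDepth-parent L o x e′)
... | inj₂ (orphan , refl) rewrite bstDepth-root {L} {o} = cong suc (bstParent≡nothing⇒bstDepth≡1 L o x x∈ orphan)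
bstDepth-parent (suc L) o x e | right x∈ with <∣>-just e
... | inj₁ e′ rewrite bstDepth-right {L} {o} (proj₂ (bstParent-range L _ x e′)) = cong suc (bstDepth-parent L _ x e′)
... | inj₂ (orphan , refl) rewrite bstDepth-root {L} {o} = cong suc (bstParent≡nothing⇒bstDepth≡1 L _ x x∈ orphan)

bst-root-ancestor : ∀ L o x → InTree (suc L) o x → Ancestorℕ (bstParent (suc L) o) (o + treeSize L) x
bst-root-ancestor L o x (o≤x , x<e) with position L o x
... | before x<o = ⊥-elim (<⇒≱ x<o o≤x)
... | after e≤x  = ⊥-elim (<⇒≱ x<e e≤x)
... | root refl  = self
bst-root-ancestor zero    o x _ | left x∈ = ⊥-elim (InTree-zero x∈)
bst-root-ancestor (suc L) o x _ | left x∈ =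
  Ancestorℕ-trans (up left-root-parent self) (Ancestorℕ-mono (bstParent-left-⊆ {suc L} {o}) (bst-root-ancestor L o x x∈))
  where
  left-root-parent : bstParent (suc (suc L)) o (o + treeSize L) ≡ just (o + treeSize (suc L))
  left-root-parent rewrite bstParent-left {suc L} {o} (InTree-root L o) | bstParent-root {L} {o} = refl
bst-root-ancestor zero    o x _ | right x∈ = ⊥-elim (InTree-zero x∈)
bst-root-ancestor (suc L) o x _ | right x∈ =
  Ancestorℕ-trans (up right-root-parent self) (Ancestorℕ-mono (bstParent-right-⊆ {suc L} {o}) (bst-root-ancestor L o′ x x∈))
  where
  o′ : ℕ
  o′ = suc (o + treeSize (suc L))
  right-root-parent : bstParent (suc (suc L)) o (o′ + treeSize L) ≡ just (o + treeSize (suc L))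
  right-root-parent rewrite bstParent-right {suc L} {o} (InTree-root L o′) | bstParent-root {L} {o′} = refl

bst-consecutive : ∀ L o x → o ≤ x → suc x < o + treeSize L →
  Ancestorℕ (bstParent L o) x (suc x) ⊎ Ancestorℕ (bstParent L o) (suc x) x
bst-consecutive zero    o x o≤x x+1<e = ⊥-elim (InTree-zero (o≤x , <-trans (n<1+n x) x+1<e))
bst-consecutive (suc L) o x o≤x x+1<e with position L o x
... | before x<o = ⊥-elim (<⇒≱ x<o o≤x)
... | after e≤x  = ⊥-elim (<⇒≱ (<-trans (n<1+n x) x+1<e) e≤x)
... | root refl  = inj₁ (bst-root-ancestor L o (suc x) (≤-trans o≤x (n≤1+n x) , x+1<e))
... | right (r<x , _) with bst-consecutive L (suc (o + treeSize L)) x r<x (subst (suc x <_) (≡.sym (rightEnd o L)) x+1<e)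
...   | inj₁ a = inj₁ (Ancestorℕ-mono (bstParent-right-⊆ {L} {o}) a)
...   | inj₂ a = inj₂ (Ancestorℕ-mono (bstParent-right-⊆ {L} {o}) a)
bst-consecutive (suc L) o x o≤x x+1<e | left (_ , x<r) with m≤n⇒m<n∨m≡n x<r
... | inj₁ x+1<r with bst-consecutive L o x o≤x x+1<r
...   | inj₁ a = inj₁ (Ancestorℕ-mono (bstParent-left-⊆ {L} {o}) a)
...   | inj₂ a = inj₂ (Ancestorℕ-mono (bstParent-left-⊆ {L} {o}) a)
bst-consecutive (suc L) o x o≤x x+1<e | left _ | inj₂ x+1≡r =
  inj₂ (subst (λ y → Ancestorℕ (bstParent (suc L) o) y x) (≡.sym x+1≡r)
    (bst-root-ancestor L o x (o≤x , <-trans (n<1+n x) x+1<e)))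

-- The apex-path graph

-- Path vertices are 0, …, N − 1 (N = m + 2), apex vertices N, …, N + a − 1.
module ApexPath (a m : ℕ) where

  N n : ℕ
  N = suc (suc m)
  n = N + a

  Join : ℕ → ℕ → Set
  Join x y = x < N × N ≤ y

  Edge : ℕ → ℕ → Set
  Edge x y = Join x y ⊎ Join y x ⊎ (x < N × y < N × Adjacent x y)

  Edge-sym : ∀ {x y} → Edge x y → Edge y x
  Edge-sym (inj₁ j)                     = inj₂ (inj₁ j)
  Edge-sym (inj₂ (inj₁ j))              = inj₁ j
  Edge-sym (inj₂ (inj₂ (x< , y< , xy))) = inj₂ (inj₂ (y< , x< , Adjacent-sym xy))

  Edge-irrefl : ∀ {x} → ¬ Edge x x
  Edge-irrefl (inj₁ (x<N , N≤x))        = <⇒≱ x<N N≤x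
  Edge-irrefl (inj₂ (inj₁ (x<N , N≤x))) = <⇒≱ x<N N≤x
  Edge-irrefl (inj₂ (inj₂ (_ , _ , xx))) = Adjacent-irrefl xx

  G : Graph n
  G = graphOnℕ n Edge Edge-sym Edge-irrefl

  connected : Connected G
  connected u v = walk-++ (walk-reverse (from-start u)) (from-start v)
    where
    from-start : ∀ v → Walk G zero v
    from-start v with toℕ v <? N
    ... | no  v≮N = step (here tt) (inj₁ (s≤s z≤n , ≮⇒≥ v≮N)) tt
    ... | yes v<N = walk-interval zero v z≤n (λ _ _ _ → tt)
      (λ z w _ w≡z+1 w≤v → inj₂ (inj₂ (<-trans (subst (_ <_) (≡.sym w≡z+1) (n<1+n _)) (≤-<-trans w≤v v<N)
                                      , ≤-<-trans w≤v v<N , inj₁ w≡z+1)))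

  InBag : ℕ → ℕ → Set
  InBag t x = (t ≤ x × x < 2 + t) ⊎ (N ≤ x × x < n)

  bag : Fin (suc m) → Subset n
  bag t = interval n (toℕ t) (2 + toℕ t) ∪ interval n N n

  bag-∈⁻ : ∀ t x → x ∈ bag t → InBag (toℕ t) (toℕ x)
  bag-∈⁻ t x x∈ with x∈p∪q⁻ (interval n _ _) _ x∈
  ... | inj₁ x∈₁ = inj₁ (interval-∈⁻ x x∈₁)
  ... | inj₂ x∈₂ = inj₂ (interval-∈⁻ x x∈₂)

  bag-∈⁺ : ∀ t x → InBag (toℕ t) (toℕ x) → x ∈ bag t
  bag-∈⁺ t x (inj₁ (t≤x , x<t+2)) = x∈p∪q⁺ (inj₁ (interval-∈⁺ x t≤x x<t+2))
  bag-∈⁺ t x (inj₂ (N≤x , x<n))   = x∈p∪q⁺ (inj₂ (interval-∈⁺ x N≤x x<n))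

  InBag-convex : ∀ {t s t′ x} → InBag t x → InBag t′ x → t ≤ s → s ≤ t′ → InBag s x
  InBag-convex (inj₂ apex)        _                  _   _    = inj₂ apex
  InBag-convex (inj₁ _)           (inj₂ apex)        _   _    = inj₂ apex
  InBag-convex (inj₁ (_ , x<t+2)) (inj₁ (t′≤x , _)) t≤s s≤t′ = inj₁ (≤-trans s≤t′ t′≤x , ≤-trans x<t+2 (s≤s (s≤s t≤s)))

  width : ∀ t → ∣ bag t ∣ ≤ suc (suc a)
  width t = ≤-trans (∣p∪q∣≤∣p∣+∣q∣ (interval n (toℕ t) (2 + toℕ t)) (interval n N n))
    (+-mono-≤ (≤-trans (∣interval∣ n (toℕ t) _) (≤-reflexive (m+n∸n≡m 2 (toℕ t))))
              (≤-trans (∣interval∣ n N n) (≤-reflexive (m+n∸m≡n N a))))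

  edgeBag : ∀ {x} → suc x < N → Σ (Fin (suc m)) λ t → InBag (toℕ t) x × InBag (toℕ t) (suc x)
  edgeBag {x} (s≤s x<N-1) = t , inj₁ (≤-reflexive t≡x , subst (λ y → x < 2 + y) (≡.sym t≡x) (n≤1+n (suc x)))
                              , inj₁ (≤-trans (≤-reflexive t≡x) (n≤1+n x) , subst (λ y → suc x < 2 + y) (≡.sym t≡x) ≤-refl)
    where
    t : Fin (suc m)
    t = clamp x
    t≡x : toℕ t ≡ x
    t≡x = toℕ-clamp x x<N-1

  pathBag : ∀ {x} → x < N → Σ (Fin (suc m)) λ t → InBag (toℕ t) x
  pathBag {zero}  _          with edgeBag {0} (s≤s (s≤s z≤n))
  ... | t , p , _ = t , p
  pathBag {suc y} y+1<N with edgeBag {y} y+1<N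
  ... | t , _ , p = t , p

  apexInBag : ∀ {x} → N ≤ toℕ x → ∀ t → x ∈ bag t
  apexInBag {x} N≤x t = bag-∈⁺ t x (inj₂ (N≤x , toℕ<n x))

  treeDecomposition : TreeDecomposition G (suc a)
  treeDecomposition = record
    { m = suc m ; T = PathGraph (suc m) ; isTree = PathGraph-isTree (suc m) ; bag = bag
    ; vcover = vcover ; ecover = ecover ; coherent = coherent ; width = width }
    where
    vcover : ∀ v → ∃[ t ] (v ∈ bag t)
    vcover v with toℕ v <? N
    ... | yes v<N = let t , p = pathBag v<N in t , bag-∈⁺ t v p
    ... | no  v≮N = zero , apexInBag (≮⇒≥ v≮N) zero
    ecover : ∀ u v → Edge (toℕ u) (toℕ v) → ∃[ t ] (u ∈ bag t × v ∈ bag t)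
    ecover u v (inj₁ (u<N , N≤v)) = let t , p = pathBag u<N in t , bag-∈⁺ t u p , apexInBag N≤v t
    ecover u v (inj₂ (inj₁ (v<N , N≤u))) = let t , p = pathBag v<N in t , apexInBag N≤u t , bag-∈⁺ t v p
    ecover u v (inj₂ (inj₂ (_ , v<N , inj₁ v≡u+1))) with edgeBag (subst (_< N) v≡u+1 v<N)
    ... | t , pu , pv = t , bag-∈⁺ t u pu , bag-∈⁺ t v (subst (InBag _) (≡.sym v≡u+1) pv)
    ecover u v (inj₂ (inj₂ (u<N , _ , inj₂ u≡v+1))) with edgeBag (subst (_< N) u≡v+1 u<N)
    ... | t , pv , pu = t , bag-∈⁺ t u (subst (InBag _) (≡.sym u≡v+1) pu) , bag-∈⁺ t v pv
    coherent : ∀ v t t′ → v ∈ bag t → v ∈ bag t′ → WalkIn (PathGraph (suc m)) (λ s → v ∈ bag s) t t′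
    coherent v = PathGraph-convex-walk (λ s → v ∈ bag s)
      (λ {t} {s} {t′} p p′ t≤s s≤t′ → bag-∈⁺ s v (InBag-convex (bag-∈⁻ t v p) (bag-∈⁻ t′ v p′) t≤s s≤t′))

  -- Robber at x can survive r more rounds: the path is long enough for r more escapes,
  -- and on the path x is at distance at least r from both ends.
  Safe : ℕ → ℕ → Set
  Safe r x = r + r + a < N × (N ≤ x ⊎ (r ≤ x × r + x < N))

  room-pred : ∀ {r} → suc r + suc r + a < N → r + r + a < N
  room-pred {r} room = <-trans (+-monoˡ-< a (+-monoʳ-< r (n<1+n r))) (<-trans (n<1+n _) room)

  Safe-pred : ∀ {r x} → Safe (suc r) x → Safe r x
  Safe-pred (room , inj₁ N≤x)             = room-pred room , inj₁ N≤x
  Safe-pred (room , inj₂ (r<x , r+x<N)) = room-pred room , inj₂ (<⇒≤ r<x , <-trans (n<1+n _) r+x<N)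

  N≤n : N ≤ n
  N≤n = m≤m+n N a

  apex≢ : ∀ {z} i → z < N → N + i ≢ z
  apex≢ {z} i z<N e = <⇒≱ z<N (≤-trans (m≤m+n N i) (≤-reflexive e))

  pathRoutes : ∀ {r} (v : Fin n) y → toℕ v ≡ suc y → suc r + suc r + a < N → r ≤ y → suc r + suc y < N →
    EscapeRoutes G (suc (suc a)) (Safe r ∘ toℕ) v
  pathRoutes {r} v y v≡y+1 room r≤y r+y+2<N =
    escapeRoutesOnℕ {R = Edge} {Edge-sym} {Edge-irrefl} {Safe r} v g g<n g-inj g≢v g-adj g-safe
    where
    y+2<N : suc (suc y) < N
    y+2<N = ≤-<-trans (s≤s (m≤n+m (suc y) r)) r+y+2<N
    y+1<N : suc y < N
    y+1<N = <-trans (n<1+n _) y+2<N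
    y<N : y < N
    y<N = <-trans (n<1+n _) y+1<N
    g : Fin (suc (suc a)) → ℕ
    g zero          = y
    g (suc zero)    = suc (suc y)
    g (suc (suc i)) = N + toℕ i
    g<n : ∀ j → g j < n
    g<n zero          = <-≤-trans y<N N≤n
    g<n (suc zero)    = <-≤-trans y+2<N N≤n
    g<n (suc (suc i)) = +-monoʳ-< N (toℕ<n i)
    g-inj : ∀ {i j} → g i ≡ g j → i ≡ j
    g-inj {zero}          {zero}          _ = refl
    g-inj {zero}          {suc zero}      e = ⊥-elim (<-irrefl e (<-trans (n<1+n y) (n<1+n (suc y))))
    g-inj {zero}          {suc (suc j)}   e = ⊥-elim (apex≢ (toℕ j) y<N (≡.sym e))
    g-inj {suc zero}      {zero}          e = ⊥-elim (<-irrefl (≡.sym e) (<-trans (n<1+n y) (n<1+n (suc y))))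
    g-inj {suc zero}      {suc zero}      _ = refl
    g-inj {suc zero}      {suc (suc j)}   e = ⊥-elim (apex≢ (toℕ j) y+2<N (≡.sym e))
    g-inj {suc (suc i)}   {zero}          e = ⊥-elim (apex≢ (toℕ i) y<N e)
    g-inj {suc (suc i)}   {suc zero}      e = ⊥-elim (apex≢ (toℕ i) y+2<N e)
    g-inj {suc (suc i)}   {suc (suc j)}   e = cong (λ k → suc (suc k)) (toℕ-injective (+-cancelˡ-≡ N _ _ e))
    g≢v : ∀ j → g j ≢ toℕ v
    g≢v zero          e = 1+n≢n (≡.sym (trans e v≡y+1))
    g≢v (suc zero)    e = 1+n≢n (suc-injective (trans e v≡y+1))
    g≢v (suc (suc i)) e = apex≢ (toℕ i) y+1<N (trans e v≡y+1)
    g-adj : ∀ j → Edge (toℕ v) (g j)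
    g-adj j = subst (λ x → Edge x (g j)) (≡.sym v≡y+1) (adj j)
      where
      adj : ∀ j → Edge (suc y) (g j)
      adj zero          = inj₂ (inj₂ (y+1<N , y<N , inj₂ refl))
      adj (suc zero)    = inj₂ (inj₂ (y+1<N , y+2<N , inj₁ refl))
      adj (suc (suc i)) = inj₁ (y+1<N , m≤m+n N _)
    g-safe : ∀ j → Safe r (g j)
    g-safe zero          = room-pred room , inj₂ (r≤y , ≤-<-trans (+-monoʳ-≤ r (n≤1+n y)) (<-trans (n<1+n _) r+y+2<N))
    g-safe (suc zero)    = room-pred room ,
      inj₂ (≤-trans r≤y (≤-trans (n≤1+n y) (n≤1+n _)) , subst (_< N) (≡.sym (+-suc r (suc y))) r+y+2<N)
    g-safe (suc (suc i)) = room-pred room , inj₁ (m≤m+n N _)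

  apexRoutes : ∀ {r} (v : Fin n) → suc r + suc r + a < N → N ≤ toℕ v →
    EscapeRoutes G (suc (suc a)) (Safe r ∘ toℕ) v
  apexRoutes {r} v room N≤v =
    escapeRoutesOnℕ {R = Edge} {Edge-sym} {Edge-irrefl} {Safe r} v g (λ j → <-≤-trans (g<N j) N≤n) g-inj g≢v
    (λ j → inj₂ (inj₁ (g<N j , N≤v))) (λ j → room-pred room , inj₂ (m≤m+n r _ , reach j))
    where
    g : Fin (suc (suc a)) → ℕ
    g j = r + toℕ j
    reach : ∀ j → r + g j < N
    reach j = begin-strict
      r + (r + toℕ j)   ≤⟨ +-monoʳ-≤ r (+-monoʳ-≤ r (≤-pred (toℕ<n j))) ⟩
      r + (r + suc a)   ≡⟨ shift r a ⟩
      r + suc r + a     <⟨ n<1+n _ ⟩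
      suc r + suc r + a <⟨ room ⟩
      N                 ∎
      where
      open ≤-Reasoning
      shift : ∀ r a → r + (r + suc a) ≡ r + suc r + a
      shift = solve-∀
    g<N : ∀ j → g j < N
    g<N j = ≤-<-trans (m≤n+m (g j) r) (reach j)
    g-inj : ∀ {i j} → g i ≡ g j → i ≡ j
    g-inj e = toℕ-injective (+-cancelˡ-≡ r _ _ e)
    g≢v : ∀ j → g j ≢ toℕ v
    g≢v j e = <⇒≱ (g<N j) (≤-trans N≤v (≤-reflexive (≡.sym e)))

  escape : ∀ {r} {v : Fin n} → Safe (suc r) (toℕ v) → EscapeRoutes G (suc (suc a)) (Safe r ∘ toℕ) v
  escape {v = v} (room , inj₁ N≤v) = apexRoutes v room N≤v
  escape {r} {v} (room , inj₂ (r<v , r+v<N)) = onPath (toℕ v) refl r<v r+v<N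
    where
    onPath : ∀ x → toℕ v ≡ x → suc r ≤ x → suc r + x < N → EscapeRoutes G (suc (suc a)) (Safe r ∘ toℕ) v
    onPath (suc y) v≡y+1 r<y+1 r+y+2<N = pathRoutes v y v≡y+1 room (≤-pred r<y+1) r+y+2<N

  robberWins : ∀ q → q + q + a < N → RobberWins G (suc (suc a)) q
  robberWins q room = v₀ , safe⇒survives G (suc (suc a)) (λ r v → Safe r (toℕ v)) Safe-pred escape q ⊥ v₀ ∉⊥ safe₀
    where
    q+q<N : q + q < N
    q+q<N = ≤-<-trans (m≤m+n (q + q) a) room
    q<n : q < n
    q<n = <-≤-trans (≤-<-trans (m≤n+m q q) q+q<N) N≤n
    v₀ : Fin n
    v₀ = fromℕ< q<n
    safe₀ : Safe q (toℕ v₀)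
    safe₀ rewrite toℕ-fromℕ< q<n = room , inj₂ (≤-refl , q+q<N)

  apexParent : ℕ → Maybe ℕ
  apexParent zero    = nothing
  apexParent (suc i) = just (N + i)

  apexParent-just : ∀ {i w} → apexParent i ≡ just w → ∃[ i′ ] (i ≡ suc i′ × w ≡ N + i′)
  apexParent-just {suc i′} refl = i′ , refl , refl

  apexParent-nothing : ∀ {i} → apexParent i ≡ nothing → i ≡ 0
  apexParent-nothing {zero} _ = refl

  apexParent-< : ∀ {i w} → i ≤ a → apexParent i ≡ just w → w < n
  apexParent-< {suc i′} i≤a refl = +-monoʳ-< N i≤a

  apexParent-pos : ∀ {i} → 0 < i → apexParent i ≡ just (N + pred i)
  apexParent-pos {suc i} _ = refl

  apexIndex≤a : ∀ {x} → x < n → x ∸ N ≤ a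
  apexIndex≤a x<n = ≤-trans (∸-monoˡ-≤ N (<⇒≤ x<n)) (≤-reflexive (m+n∸m≡n N a))

  apexIndex<a : ∀ {x} → N ≤ x → x < n → x ∸ N < a
  apexIndex<a N≤x x<n = +-cancelˡ-< N _ _ (subst (_< n) (≡.sym (m+[n∸m]≡n N≤x)) x<n)

  -- The apex vertices form a chain rooted at N whose last vertex is the parent of the search-tree root.
  module Elimination (H′ : ℕ) (size : treeSize (suc H′) ≡ N) where

    H : ℕ
    H = suc H′

    parent : ℕ → Maybe ℕ
    parent x with x <? N
    ... | yes _ = bstParent H 0 x <∣> apexParent a
    ... | no  _ = apexParent (x ∸ N)

    depthOf : ℕ → ℕ
    depthOf x with x <? N
    ... | yes _ = a + bstDepth H 0 x
    ... | no  _ = suc (x ∸ N)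

    onPath : ∀ {x} → x < N → InTree H 0 x
    onPath {x} x<N = z≤n , subst (x <_) (≡.sym size) x<N

    parent-path : ∀ {x} → x < N → parent x ≡ bstParent H 0 x <∣> apexParent a
    parent-path {x} x<N with x <? N
    ... | yes _   = refl
    ... | no  x≮N = ⊥-elim (x≮N x<N)

    parent-apex : ∀ i → parent (N + i) ≡ apexParent i
    parent-apex i with N + i <? N
    ... | yes N+i<N = ⊥-elim (m+n≮m N i N+i<N)
    ... | no  _     = cong apexParent (m+n∸m≡n N i)

    depthOf-path : ∀ {x} → x < N → depthOf x ≡ a + bstDepth H 0 x
    depthOf-path {x} x<N with x <? N
    ... | yes _   = refl
    ... | no  x≮N = ⊥-elim (x≮N x<N)

    depthOf-apex : ∀ i → depthOf (N + i) ≡ suc i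
    depthOf-apex i with N + i <? N
    ... | yes N+i<N = ⊥-elim (m+n≮m N i N+i<N)
    ... | no  _     = cong suc (m+n∸m≡n N i)

    bstParent<N : ∀ {x w} → bstParent H 0 x ≡ just w → w < N
    bstParent<N {x} {w} e = subst (w <_) size (proj₂ (proj₂ (bstParent-range H 0 x e)))

    forest : ForestOnℕ n
    forest = record
      { parent = parent ; depthOf = depthOf
      ; parent-< = parent-< ; depthOf-root = depthOf-root ; depthOf-parent = depthOf-parent }
      where
      parent-< : ∀ {x w} → x < n → parent x ≡ just w → w < n
      parent-< {x} x<n e with x <? N
      ... | no _ = apexParent-< (apexIndex≤a x<n) e
      ... | yes x<N with <∣>-just {bstParent H 0 x} e
      ...   | inj₁ e′       = <-≤-trans (bstParent<N e′) N≤n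
      ...   | inj₂ (_ , e′) = apexParent-< ≤-refl e′

      depthOf-root : ∀ {x} → x < n → parent x ≡ nothing → depthOf x ≡ 1
      depthOf-root {x} x<n e with x <? N
      ... | no _ = cong suc (apexParent-nothing e)
      ... | yes x<N with <∣>-nothing {bstParent H 0 x} e
      ...   | orphan , no-apex rewrite apexParent-nothing no-apex =
        bstParent≡nothing⇒bstDepth≡1 H 0 x (onPath x<N) orphan

      depthOf-parent : ∀ {x w} → x < n → parent x ≡ just w → depthOf x ≡ suc (depthOf w)
      depthOf-parent {x} x<n e with x <? N
      ... | no _ with apexParent-just e
      ...   | i , x-N≡i+1 , refl rewrite depthOf-apex i = cong suc x-N≡i+1
      depthOf-parent {x} x<n e | yes x<N with <∣>-just {bstParent H 0 x} e
      ... | inj₁ e′ rewrite depthOf-path (bstParent<N e′) | bstDepth-parent H 0 x e′ = +-suc a _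
      ... | inj₂ (orphan , e′) with apexParent-just e′
      ...   | a′ , a≡a′+1 , refl
        rewrite depthOf-apex a′ | a≡a′+1 | bstParent≡nothing⇒bstDepth≡1 H 0 x (onPath x<N) orphan =
        cong suc (+-comm a′ 1)

    bstParent⊆parent : ∀ {z w} → bstParent H 0 z ≡ just w → parent z ≡ just w
    bstParent⊆parent {z} e rewrite parent-path (subst (z <_) size (proj₂ (proj₁ (bstParent-range H 0 z e)))) | e = refl

    apex-chain : ∀ {i} j → i ≤ j → Ancestorℕ parent (N + i) (N + j)
    apex-chain zero    z≤n = self
    apex-chain (suc j) i≤j+1 with m≤n⇒m<n∨m≡n i≤j+1
    ... | inj₂ refl      = self
    ... | inj₁ (s≤s i≤j) = up (parent-apex (suc j)) (apex-chain j i≤j)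

    apex-ancestor : ∀ {x y} → x < N → N ≤ y → y < n → Ancestorℕ parent y x
    apex-ancestor {x} {y} x<N N≤y y<n = subst (λ z → Ancestorℕ parent z x) (m+[n∸m]≡n N≤y)
      (Ancestorℕ-trans (apex-chain (pred a) (<⇒≤pred i<a))
        (Ancestorℕ-trans (up root-parent self)
          (Ancestorℕ-mono bstParent⊆parent (bst-root-ancestor H′ 0 x (onPath x<N)))))
      where
      i<a : y ∸ N < a
      i<a = apexIndex<a N≤y y<n
      root-parent : parent (treeSize H′) ≡ just (N + pred a)
      root-parent rewrite parent-path (subst (treeSize H′ <_) size (proj₂ (InTree-root H′ 0))) | bstParent-root {H′} {0} =
        apexParent-pos (≤-<-trans z≤n i<a)

    consecutive : ∀ {x} → suc x < N → Ancestorℕ parent x (suc x) ⊎ Ancestorℕ parent (suc x) x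
    consecutive {x} x+1<N with bst-consecutive H 0 x z≤n (subst (suc x <_) (≡.sym size) x+1<N)
    ... | inj₁ anc = inj₁ (Ancestorℕ-mono bstParent⊆parent anc)
    ... | inj₂ anc = inj₂ (Ancestorℕ-mono bstParent⊆parent anc)

    comparable : ∀ u v → Edge (toℕ u) (toℕ v) →
      Ancestorℕ parent (toℕ u) (toℕ v) ⊎ Ancestorℕ parent (toℕ v) (toℕ u)
    comparable u v (inj₁ (u<N , N≤v))        = inj₂ (apex-ancestor u<N N≤v (toℕ<n v))
    comparable u v (inj₂ (inj₁ (v<N , N≤u))) = inj₁ (apex-ancestor v<N N≤u (toℕ<n u))
    comparable u v (inj₂ (inj₂ (_ , v<N , inj₁ v≡u+1))) rewrite v≡u+1 = consecutive v<N
    comparable u v (inj₂ (inj₂ (u<N , _ , inj₂ u≡v+1))) rewrite u≡v+1 with consecutive u<N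
    ... | inj₁ anc = inj₂ anc
    ... | inj₂ anc = inj₁ anc

    depthOf≤ : ∀ x → x < n → depthOf x ≤ a + H
    depthOf≤ x x<n with x <? N
    ... | yes _   = +-monoʳ-≤ a (bstDepth-≤ H 0 x)
    ... | no  x≮N = ≤-trans (apexIndex<a (≮⇒≥ x≮N) x<n) (m≤m+n a H)

  inTD : ∀ H′ → treeSize (suc H′) ≡ N → InTD (a + suc H′) G
  inTD H′ size = InTD-fromForestOnℕ G forest comparable depthOf≤
    where open Elimination H′ size

robberWinningGraph : ∀ a q H → a + H ≤ q → q + q + a < treeSize H →
  Σ ℕ λ n → Σ (Graph n) λ G → Connected G × InTW (suc a) G × InTD q G × RobberWins G (suc (suc a)) q
robberWinningGraph a q zero     _     ()
robberWinningGraph a q (suc H′) a+H≤q room =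
  _ , G , connected , treeDecomposition , InTD-mono {G = G} a+H≤q (inTD H′ size) ,
  robberWins q (subst (q + q + a <_) size room)
  where
  S : ℕ
  S = treeSize (suc H′)
  2≤S : 2 ≤ S
  2≤S = <⇒≤ (≤-<-trans (+-mono-≤ 1≤q 1≤q) (≤-<-trans (m≤m+n (q + q) a) room))
    where
    1≤q : 1 ≤ q
    1≤q = ≤-trans (s≤s z≤n) (≤-trans (m≤n+m (suc H′) a) a+H≤q)
  size : S ≡ suc (suc (S ∸ 2))
  size = ≡.sym (m+[n∸m]≡n 2≤S)
  open ApexPath a (S ∸ 2)

suc-treeSize : ∀ h → suc (treeSize h) ≡ 2 ^ h
suc-treeSize zero    = refl
suc-treeSize (suc h) = begin
  suc (suc (treeSize h + treeSize h)) ≡⟨ 2+s+s≡2*[1+s] (treeSize h) ⟩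
  2 * suc (treeSize h)                ≡⟨ cong (2 *_) (suc-treeSize h) ⟩
  2 * 2 ^ h                           ∎
  where
  open ≡-Reasoning
  2+s+s≡2*[1+s] : ∀ s → suc (suc (s + s)) ≡ 2 * suc s
  2+s+s≡2*[1+s] = solve-∀

2^a*suc[a]≤8^a : ∀ a → 2 ^ a * suc a ≤ 8 ^ a
2^a*suc[a]≤8^a zero    = ≤-refl
2^a*suc[a]≤8^a (suc a) = begin
  2 ^ suc a * suc (suc a)       ≤⟨ *-monoʳ-≤ (2 ^ suc a) (m≤n+m (suc (suc a)) a) ⟩
  2 ^ suc a * (a + suc (suc a)) ≡⟨ regroup (2 ^ a) a ⟩
  4 * (2 ^ a * suc a)           ≤⟨ *-monoʳ-≤ 4 (2^a*suc[a]≤8^a a) ⟩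
  4 * 8 ^ a                     ≤⟨ *-monoˡ-≤ (8 ^ a) (m≤m+n 4 4) ⟩
  8 * 8 ^ a                     ∎
  where
  open ≤-Reasoning
  regroup : ∀ x a → 2 * x * (a + suc (suc a)) ≡ 4 * (x * suc a)
  regroup = solve-∀

2^a*[2q+a+2]≤[8q]^[1+a] : ∀ a q → 1 ≤ q → 2 ^ a * suc (suc (q + q + a)) ≤ (8 * q) ^ suc a
2^a*[2q+a+2]≤[8q]^[1+a] a (suc q₀) _ = begin
  2 ^ a * suc (suc (q + q + a))  ≤⟨ *-monoʳ-≤ (2 ^ a) (≤-trans (m≤m+n _ _) (≤-reflexive (≡.sym (expand q₀ a)))) ⟩
  2 ^ a * (8 * q * suc a)        ≡⟨ swap (2 ^ a) (8 * q) (suc a) ⟩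
  8 * q * (2 ^ a * suc a)        ≤⟨ *-monoʳ-≤ (8 * q) (2^a*suc[a]≤8^a a) ⟩
  8 * q * 8 ^ a                  ≤⟨ *-monoʳ-≤ (8 * q) (^-monoˡ-≤ a (m≤m*n 8 q)) ⟩
  8 * q * (8 * q) ^ a            ∎
  where
  open ≤-Reasoning
  q : ℕ
  q = suc q₀
  expand : ∀ q₀ a → 8 * suc q₀ * suc a ≡ suc (suc (suc q₀ + suc q₀ + a)) + (8 * q₀ * a + 6 * q₀ + 7 * a + 4)
  expand = solve-∀
  swap : ∀ x y z → x * (y * z) ≡ y * (x * z)
  swap = solve-∀

room-from-hypothesis : ∀ a q → 1 ≤ q → (8 * q) ^ suc a ≤ 2 ^ q → a ≤ q × q + q + a < treeSize (q ∸ a)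
room-from-hypothesis a q 1≤q hyp = a≤q , ≤-pred (subst (X ≤_) (≡.sym (suc-treeSize (q ∸ a))) X≤2^[q-a])
  where
  X : ℕ
  X = suc (suc (q + q + a))
  bound : 2 ^ a * X ≤ 2 ^ q
  bound = ≤-trans (2^a*[2q+a+2]≤[8q]^[1+a] a q 1≤q) hyp
  a≤q : a ≤ q
  a≤q = ≮⇒≥ λ q<a → <⇒≱ (^-monoʳ-< 2 (s≤s (s≤s z≤n)) q<a) (≤-trans (m≤m*n (2 ^ a) X) bound)
  instance
    2^a≢0 : NonZero (2 ^ a)
    2^a≢0 = m^n≢0 2 a
  X≤2^[q-a] : X ≤ 2 ^ (q ∸ a)
  X≤2^[q-a] = *-cancelˡ-≤ (2 ^ a) (≤-trans bound (≤-reflexive (begin-equality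
    2 ^ q               ≡⟨ cong (2 ^_) (≡.sym (m+[n∸m]≡n a≤q)) ⟩
    2 ^ (a + (q ∸ a))   ≡⟨ ^-distribˡ-+-* 2 a (q ∸ a) ⟩
    2 ^ a * 2 ^ (q ∸ a) ∎)))
    where open ≤-Reasoning

1+2q≤treeSize : ∀ q → 3 ≤ q → suc (q + q) ≤ treeSize q
1+2q≤treeSize (suc zero)             (s≤s ())
1+2q≤treeSize (suc (suc zero))       (s≤s (s≤s ()))
1+2q≤treeSize (suc (suc (suc zero))) _ = ≤-refl
1+2q≤treeSize (suc q@(suc (suc (suc _)))) _ = s≤s (begin
  suc q + suc q                      ≡⟨ cong suc (+-suc q q) ⟩
  suc (suc (q + q))                  ≤⟨ m≤n+m _ (q + q) ⟩
  q + q + suc (suc (q + q))          ≡⟨ regroup q ⟩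
  suc (q + q) + suc (q + q)          ≤⟨ +-mono-≤ (1+2q≤treeSize q 3≤q) (1+2q≤treeSize q 3≤q) ⟩
  treeSize q + treeSize q            ∎)
  where
  open ≤-Reasoning
  3≤q : 3 ≤ q
  3≤q = s≤s (s≤s (s≤s z≤n))
  regroup : ∀ q → q + q + suc (suc (q + q)) ≡ suc (q + q) + suc (q + q)
  regroup = solve-∀

lemma4p27 : (∀ (k q : ℕ) → 1 ≤ k → 1 ≤ q → 2 ≤ k ∸ 1 → (8 * q) ^ (k ∸ 1) ≤ 2 ^ q →
    Σ ℕ λ n → Σ (Graph n) λ G →
    Connected G × InTW (k ∸ 1) G × InTD q G × RobberWins G k q)
    × (∀ (q : ℕ) → 3 ≤ q →
    Σ ℕ λ n → Σ (Graph n) λ G →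
    Connected G × InTW 1 G × InTD q G × RobberWins G 2 q)
lemma4p27 = treewidth-case , path-case
  where
  treewidth-case : ∀ k q → 1 ≤ k → 1 ≤ q → 2 ≤ k ∸ 1 → (8 * q) ^ (k ∸ 1) ≤ 2 ^ q →
    Σ ℕ λ n → Σ (Graph n) λ G → Connected G × InTW (k ∸ 1) G × InTD q G × RobberWins G k q
  treewidth-case (suc (suc zero))    _ _ _   (s≤s ()) _
  treewidth-case (suc (suc (suc a))) q _ 1≤q _ hyp with room-from-hypothesis (suc a) q 1≤q hyp
  ... | a≤q , room = robberWinningGraph (suc a) q (q ∸ suc a) (≤-reflexive (m+[n∸m]≡n a≤q)) room
  path-case : ∀ q → 3 ≤ q →
    Σ ℕ λ n → Σ (Graph n) λ G → Connected G × InTW 1 G × InTD q G × RobberWins G 2 q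
  path-case q 3≤q =
    robberWinningGraph 0 q q ≤-refl (subst (_< treeSize q) (≡.sym (+-identityʳ (q + q))) (1+2q≤treeSize q 3≤q))
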